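{- Let $h(x)$ be a polynomial with real coefficients, and let $F_{h,n}(x)$ and $L_{h,n}(x)$ be defined by $F_{h,0}=0$, $F_{h,1}=1$, $F_{h,n+1}=h(x)F_{h,n}+F_{h,n-1}$ and $L_{h,0}=2$, $L_{h,1}=h(x)$, $L_{h,n+1}=h(x)L_{h,n}+L_{h,n-1}$ ($n\ge1$). Then for every integer $n\ge 1$, $$\sum_{i=0}^{\lfloor (n-1)/2\rfloor} i\binom{n-1-i}{i}h^{n-1-2i}(x)=\frac{\big((h^2(x)+4)n-4\big)F_{h,n}(x)-nh(x)L_{h,n}(x)}{2\,(h^2(x)+4)}.$$
   Context: $h(x)$ is a polynomial with real coefficients; $h^k(x)$ denotes $(h(x))^k$. $F_{h,n}(x)$ are the $h(x)$-Fibonacci polynomials and $L_{h,n}(x)$ the $h(x)$-Lucas polynomials. -}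

module Defs where

open import Level using (Level)
open import Data.Nat as ℕ using (ℕ; zero; suc; _∸_)
open import Data.Nat.DivMod using (_/_)
open import Data.Nat.Combinatorics using (_C_)
open import Algebra.Bundles using (CommutativeRing)

module _ {c ℓ : Level} (R : CommutativeRing c ℓ) where
  open CommutativeRing R

  natR : ℕ → Carrier
  natR zero = 0#
  natR (suc n) = 1# + natR n

  powR : Carrier → ℕ → Carrier
  powR x zero = 1#
  powR x (suc k) = x * powR x k

  sumTo : ℕ → (ℕ → Carrier) → Carrier
  sumTo zero f = f 0
  sumTo (suc m) f = sumTo m f + f (suc m)

  Fib : Carrier → ℕ → Carrier
  Fib h zero = 0#
  Fib h (suc zero) = 1#
  Fib h (suc (suc n)) = h * Fib h (suc n) + Fib h n

  Luc : Carrier → ℕ → Carrier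
  Luc h zero = 1# + 1#
  Luc h (suc zero) = h
  Luc h (suc (suc n)) = h * Luc h (suc n) + Luc h n

  lhsSum : Carrier → ℕ → Carrier
  lhsSum h n = sumTo ((n ∸ 1) / 2)
    (λ i → natR i * natR ((n ∸ 1 ∸ i) C i) * powR h (n ∸ 1 ∸ (i ℕ.+ i)))

-- Write S_w(m) = Σ_{i+j=m} w_i C(j,i) h^(j-i), so that the left-hand side is S_w(n-1) for
-- w_i = i. Pascal's rule gives S_w(m+2) = h S_w(m+1) + S_{w(·+1)}(m): for w = 1 this is the
-- Fibonacci recurrence, so S_1(m) = F_(m+1), and for w_i = i it becomes
-- G(m+2) = h G(m+1) + G(m) + F(m+1). The closed form, in the division-free shape
-- 2(h²+4) G(m) + 4 F_n + n h L_n = (h²+4) n F_n with n = m+1, then follows by two-step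
-- induction from h L_(k+1) + 2 L_k = (h²+4) F_(k+1).
module Submission where

open import Defs
open import Level using (Level)
open import Function using (_∘_)
open import Data.Nat as ℕ using (ℕ; zero; suc; _∸_; _≤_; _<_; z≤n; s≤s)
import Data.Nat.Properties as ℕₚ
open import Data.Nat.DivMod using (_/_; m*n/n≡m; /-monoˡ-≤; m/n≤m)
open import Data.Nat.Combinatorics using (_C_; k>n⇒nCk≡0; nCk+nC[k+1]≡[n+1]C[k+1])
open import Data.Sum using (inj₁; inj₂)
open import Relation.Nullary using (yes; no)
import Relation.Binary.PropositionalEquality as P
open import Algebra.Bundles using (CommutativeRing)
import Algebra.Properties.Group as GroupProperties
import Algebra.Properties.AbelianGroup as AbelianGroupProperties
import Algebra.Properties.Ring as RingProperties
import Algebra.Properties.CommutativeSemigroup as CommutativeSemigroupProperties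
import Algebra.Solver.Ring.NaturalCoefficients.Default as NaturalSolver

m/2<n⇒m∸n<n : ∀ m n → m / 2 < n → m ∸ n < n
m/2<n⇒m∸n<n m n m/2<n = ℕₚ.≰⇒> λ n≤m∸n → ℕₚ.<⇒≱ m/2<n (begin
    n           ≡⟨ m*n/n≡m n 2 ⟨
    n ℕ.* 2 / 2 ≤⟨ /-monoˡ-≤ 2 (n*2≤m n≤m∸n) ⟩
    m / 2       ∎)
  where
  open ℕₚ.≤-Reasoning
  n*2≤m : n ≤ m ∸ n → n ℕ.* 2 ≤ m
  n*2≤m n≤m∸n = begin
    n ℕ.* 2         ≡⟨ ℕₚ.*-comm n 2 ⟩
    n ℕ.+ (n ℕ.+ 0) ≡⟨ P.cong (n ℕ.+_) (ℕₚ.+-identityʳ n) ⟩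
    n ℕ.+ n         ≤⟨ ℕₚ.+-monoˡ-≤ n n≤m∸n ⟩
    m ∸ n ℕ.+ n     ≡⟨ ℕₚ.m∸n+n≡m (ℕₚ.≤-trans n≤m∸n (ℕₚ.m∸n≤m m n)) ⟩
    m               ∎

module _ {c ℓ : Level} (R : CommutativeRing c ℓ) where
  open CommutativeRing R
  open import Relation.Binary.Reasoning.Setoid setoid
  open NaturalSolver commutativeSemiring
  open GroupProperties +-group using (x≈z//y)
  open AbelianGroupProperties +-abelianGroup using (⁻¹-∙-comm)
  open RingProperties ring using ([y-z]x≈yx-zx)
  open CommutativeSemigroupProperties *-commutativeSemigroup using (x∙yz≈y∙xz)

  -- Unlike con 4, this evaluates to natR R 4 definitionally.
  ⟨4⟩ : ∀ {n} → Polynomial n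
  ⟨4⟩ = con 1 :+ (con 1 :+ (con 1 :+ (con 1 :+ con 0)))

  natR-homo-+ : ∀ m n → natR R (m ℕ.+ n) ≈ natR R m + natR R n
  natR-homo-+ zero    n = sym (+-identityˡ _)
  natR-homo-+ (suc m) n = trans (+-congˡ (natR-homo-+ m n)) (sym (+-assoc _ _ _))

  x+[yz+w]≈uz⇒x≈[u-y]z-w : ∀ {x y z w u} → x + (y * z + w) ≈ u * z → x ≈ (u - y) * z - w
  x+[yz+w]≈uz⇒x≈[u-y]z-w {x} {y} {z} {w} {u} eq = begin
    x                         ≈⟨ x≈z//y x _ _ eq ⟩
    u * z - (y * z + w)       ≈⟨ +-congˡ (⁻¹-∙-comm _ _) ⟨
    u * z + (- (y * z) + - w) ≈⟨ +-assoc _ _ _ ⟨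
    u * z - y * z - w         ≈⟨ +-congʳ ([y-z]x≈yx-zx z u y) ⟨
    (u - y) * z - w           ∎

  d*a≈1⇒a*x≈y⇒x≈y*d : ∀ {a d x y} → d * a ≈ 1# → a * x ≈ y → x ≈ y * d
  d*a≈1⇒a*x≈y⇒x≈y*d {a} {d} {x} {y} da≈1 ax≈y = begin
    x             ≈⟨ *-identityˡ x ⟨
    1# * x        ≈⟨ *-congʳ da≈1 ⟨
    d * a * x     ≈⟨ *-assoc d a x ⟩
    d * (a * x)   ≈⟨ *-congˡ ax≈y ⟩
    d * y         ≈⟨ *-comm d y ⟩
    y * d         ∎

  sumTo-cong : ∀ N {f g : ℕ → Carrier} → (∀ i → f i ≈ g i) → sumTo R N f ≈ sumTo R N g
  sumTo-cong zero    f≈g = f≈g 0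
  sumTo-cong (suc N) f≈g = +-cong (sumTo-cong N f≈g) (f≈g (suc N))

  sumTo-uncons : ∀ N (f : ℕ → Carrier) → sumTo R (suc N) f ≈ f 0 + sumTo R N (f ∘ suc)
  sumTo-uncons zero    f = refl
  sumTo-uncons (suc N) f = trans (+-congʳ (sumTo-uncons N f)) (+-assoc _ _ _)

  sumTo-zero-tail : ∀ {N M} (f : ℕ → Carrier) → (∀ i → N < i → f i ≈ 0#) →
                    N ≤ M → sumTo R M f ≈ sumTo R N f
  sumTo-zero-tail {M = zero} f _ z≤n = refl
  sumTo-zero-tail {N} {suc M} f tail≈0 N≤1+M with ℕₚ.m≤n⇒m<n∨m≡n N≤1+M
  ... | inj₁ (s≤s N≤M) =
    trans (+-cong (sumTo-zero-tail f tail≈0 N≤M) (tail≈0 (suc M) (s≤s N≤M))) (+-identityʳ _)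
  ... | inj₂ P.refl = refl

  antidiagonalSum : (ℕ → ℕ → Carrier) → ℕ → Carrier
  antidiagonalSum g zero    = g 0 0
  antidiagonalSum g (suc m) = g 0 (suc m) + antidiagonalSum (g ∘ suc) m

  sumTo≈antidiagonalSum : ∀ m (g : ℕ → ℕ → Carrier) →
                          sumTo R m (λ i → g i (m ∸ i)) ≈ antidiagonalSum g m
  sumTo≈antidiagonalSum zero    g = refl
  sumTo≈antidiagonalSum (suc m) g =
    trans (sumTo-uncons m _) (+-congˡ (sumTo≈antidiagonalSum m (g ∘ suc)))

  antidiagonalSum-cong : ∀ m {f g : ℕ → ℕ → Carrier} → (∀ i j → f i j ≈ g i j) →
                         antidiagonalSum f m ≈ antidiagonalSum g m
  antidiagonalSum-cong zero    f≈g = f≈g 0 0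
  antidiagonalSum-cong (suc m) f≈g = +-cong (f≈g 0 (suc m)) (antidiagonalSum-cong m (f≈g ∘ suc))

  antidiagonalSum-distrib-+ : ∀ m (f g : ℕ → ℕ → Carrier) →
    antidiagonalSum (λ i j → f i j + g i j) m ≈ antidiagonalSum f m + antidiagonalSum g m
  antidiagonalSum-distrib-+ zero    f g = refl
  antidiagonalSum-distrib-+ (suc m) f g = begin
    f 0 (suc m) + g 0 (suc m) + antidiagonalSum (λ i j → f (suc i) j + g (suc i) j) m
      ≈⟨ +-congˡ (antidiagonalSum-distrib-+ m (f ∘ suc) (g ∘ suc)) ⟩
    f 0 (suc m) + g 0 (suc m) + (antidiagonalSum (f ∘ suc) m + antidiagonalSum (g ∘ suc) m)
      ≈⟨ solve 4 (λ a b x y → (a :+ b) :+ (x :+ y) := (a :+ x) :+ (b :+ y)) refl _ _ _ _ ⟩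
    antidiagonalSum f (suc m) + antidiagonalSum g (suc m) ∎

  *-distribˡ-antidiagonalSum : ∀ m x (g : ℕ → ℕ → Carrier) →
    antidiagonalSum (λ i j → x * g i j) m ≈ x * antidiagonalSum g m
  *-distribˡ-antidiagonalSum zero    x g = refl
  *-distribˡ-antidiagonalSum (suc m) x g =
    trans (+-congˡ (*-distribˡ-antidiagonalSum m x (g ∘ suc))) (sym (distribˡ _ _ _))

  antidiagonalSum-unsnoc : ∀ m (g : ℕ → ℕ → Carrier) →
    antidiagonalSum g (suc m) ≈ antidiagonalSum (λ i j → g i (suc j)) m + g (suc m) 0
  antidiagonalSum-unsnoc zero    g = refl
  antidiagonalSum-unsnoc (suc m) g =
    trans (+-congˡ (antidiagonalSum-unsnoc m (g ∘ suc))) (sym (+-assoc _ _ _))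

  module _ (h : Carrier) where

    binomialTerm : (ℕ → Carrier) → ℕ → ℕ → Carrier
    binomialTerm w i j = w i * natR R (j C i) * powR R h (j ∸ i)

    binomialSum : (ℕ → Carrier) → ℕ → Carrier
    binomialSum w = antidiagonalSum (binomialTerm w)

    binomialTerm-vanishes : ∀ w {i j} → j < i → binomialTerm w i j ≈ 0#
    binomialTerm-vanishes w j<i rewrite k>n⇒nCk≡0 j<i = trans (*-congʳ (zeroʳ _)) (zeroˡ _)

    binomial-pow-shift : ∀ j i → natR R (j C suc i) * powR R h (j ∸ i)
                                 ≈ h * (natR R (j C suc i) * powR R h (j ∸ suc i))
    binomial-pow-shift j i with i ℕₚ.<? j
    ... | yes i<j rewrite ℕₚ.+-∸-assoc 1 i<j = x∙yz≈y∙xz _ _ _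
    ... | no  i≮j rewrite k>n⇒nCk≡0 (s≤s (ℕₚ.≮⇒≥ i≮j)) =
      solve 3 (λ x p q → con 0 :* p := x :* (con 0 :* q)) refl h _ _

    binomialTerm-pascal : ∀ w i j → binomialTerm w (suc i) (suc j)
                                    ≈ h * binomialTerm w (suc i) j + binomialTerm (w ∘ suc) i j
    binomialTerm-pascal w i j = begin
      W * natR R (suc j C suc i) * p
        ≡⟨ P.cong (λ k → W * natR R k * p) (nCk+nC[k+1]≡[n+1]C[k+1] j i) ⟨
      W * natR R (j C i ℕ.+ j C suc i) * p
        ≈⟨ *-congʳ (*-congˡ (natR-homo-+ (j C i) (j C suc i))) ⟩
      W * (A + B) * p
        ≈⟨ solve 4 (λ W A B p → W :* (A :+ B) :* p := W :* (B :* p) :+ W :* A :* p) refl W A B p ⟩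
      W * (B * p) + W * A * p       ≈⟨ +-congʳ (*-congˡ (binomial-pow-shift j i)) ⟩
      W * (h * (B * q)) + W * A * p ≈⟨ +-congʳ (x∙yz≈y∙xz W h (B * q)) ⟩
      h * (W * (B * q)) + W * A * p ≈⟨ +-congʳ (*-congˡ (*-assoc W B q)) ⟨
      h * (W * B * q) + W * A * p   ∎
      where
      W = w (suc i)
      A = natR R (j C i)
      B = natR R (j C suc i)
      p = powR R h (j ∸ i)
      q = powR R h (j ∸ suc i)

    binomialSum-rec : ∀ w m → binomialSum w (suc (suc m))
                              ≈ h * binomialSum w (suc m) + binomialSum (w ∘ suc) m
    binomialSum-rec w m = begin
      t 0 (2 ℕ.+ m) + antidiagonalSum (t ∘ suc) (suc m)
        ≈⟨ +-congˡ (antidiagonalSum-unsnoc m (t ∘ suc)) ⟩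
      t 0 (2 ℕ.+ m) + (antidiagonalSum (λ i j → t (suc i) (suc j)) m + t (2 ℕ.+ m) 0)
        ≈⟨ +-congˡ (+-cong (antidiagonalSum-cong m (binomialTerm-pascal w))
                           (binomialTerm-vanishes w (s≤s z≤n))) ⟩
      t 0 (2 ℕ.+ m) + (antidiagonalSum (λ i j → h * t (suc i) j + binomialTerm (w ∘ suc) i j) m + 0#)
        ≈⟨ +-congˡ (+-identityʳ _) ⟩
      t 0 (2 ℕ.+ m) + antidiagonalSum (λ i j → h * t (suc i) j + binomialTerm (w ∘ suc) i j) m
        ≈⟨ +-congˡ (antidiagonalSum-distrib-+ m _ _) ⟩
      t 0 (2 ℕ.+ m) + (antidiagonalSum (λ i j → h * t (suc i) j) m + binomialSum (w ∘ suc) m)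
        ≈⟨ +-congˡ (+-congʳ (*-distribˡ-antidiagonalSum m h (t ∘ suc))) ⟩
      t 0 (2 ℕ.+ m) + (h * antidiagonalSum (t ∘ suc) m + binomialSum (w ∘ suc) m)
        ≈⟨ +-congʳ (x∙yz≈y∙xz _ h _) ⟩
      h * t 0 (suc m) + (h * antidiagonalSum (t ∘ suc) m + binomialSum (w ∘ suc) m)
        ≈⟨ solve 4 (λ x a b c → x :* a :+ (x :* b :+ c) := x :* (a :+ b) :+ c) refl h _ _ _ ⟩
      h * binomialSum w (suc m) + binomialSum (w ∘ suc) m ∎
      where t = binomialTerm w

    binomialSum-1≈Fib : ∀ m → binomialSum (λ _ → 1#) m ≈ Fib R h (suc m)
    binomialSum-1≈Fib zero          = solve 0 (con 1 :* (con 1 :+ con 0) :* con 1 := con 1) refl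
    binomialSum-1≈Fib (suc zero)    =
      solve 1 (λ x → con 1 :* (con 1 :+ con 0) :* (x :* con 1) :+ con 1 :* con 0 :* con 1
                     := x :* con 1 :+ con 0) refl h
    binomialSum-1≈Fib (suc (suc m)) =
      trans (binomialSum-rec (λ _ → 1#) m)
            (+-cong (*-congˡ (binomialSum-1≈Fib (suc m))) (binomialSum-1≈Fib m))

    binomialSum-natR-rec : ∀ m → binomialSum (natR R) (suc (suc m))
                                 ≈ h * binomialSum (natR R) (suc m) + (binomialSum (natR R) m + Fib R h (suc m))
    binomialSum-natR-rec m = begin
      G (suc (suc m))
        ≈⟨ binomialSum-rec (natR R) m ⟩
      h * G (suc m) + binomialSum (λ i → 1# + natR R i) m
        ≈⟨ +-congˡ (antidiagonalSum-cong m λ i j → trans (*-congʳ (distribʳ _ _ _)) (distribʳ _ _ _)) ⟩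
      h * G (suc m) + antidiagonalSum (λ i j → binomialTerm (λ _ → 1#) i j + binomialTerm (natR R) i j) m
        ≈⟨ +-congˡ (antidiagonalSum-distrib-+ m _ _) ⟩
      h * G (suc m) + (binomialSum (λ _ → 1#) m + G m)
        ≈⟨ +-congˡ (trans (+-comm _ _) (+-congˡ (binomialSum-1≈Fib m))) ⟩
      h * G (suc m) + (G m + Fib R h (suc m)) ∎
      where G = binomialSum (natR R)

    -- the discriminant of t² - h t - 1, the characteristic polynomial of both recurrences
    Δ : Carrier
    Δ = h * h + natR R 4

    h*Luc+2*Luc≈Δ*Fib : ∀ k → h * Luc R h (suc k) + (1# + 1#) * Luc R h k ≈ Δ * Fib R h (suc k)
    h*Luc+2*Luc≈Δ*Fib zero          =
      solve 1 (λ x → x :* x :+ con 2 :* con 2 := (x :* x :+ ⟨4⟩) :* con 1) refl h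
    h*Luc+2*Luc≈Δ*Fib (suc zero)    =
      solve 1 (λ x → x :* (x :* x :+ con 2) :+ con 2 :* x := (x :* x :+ ⟨4⟩) :* (x :* con 1 :+ con 0)) refl h
    h*Luc+2*Luc≈Δ*Fib (suc (suc k)) = begin
      h * (h * L₂ + L₁) + (1# + 1#) * (h * L₁ + L₀)
        ≈⟨ solve 4 (λ x a b c → x :* (x :* a :+ b) :+ con 2 :* (x :* b :+ c)
                              := x :* (x :* a :+ con 2 :* b) :+ (x :* b :+ con 2 :* c)) refl h L₂ L₁ L₀ ⟩
      h * (h * L₂ + (1# + 1#) * L₁) + (h * L₁ + (1# + 1#) * L₀)
        ≈⟨ +-cong (*-congˡ (h*Luc+2*Luc≈Δ*Fib (suc k))) (h*Luc+2*Luc≈Δ*Fib k) ⟩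
      h * (Δ * F₂) + Δ * F₁
        ≈⟨ solve 4 (λ x D a b → x :* (D :* a) :+ D :* b := D :* (x :* a :+ b)) refl h Δ F₂ F₁ ⟩
      Δ * (h * F₂ + F₁) ∎
      where
      L₂ = Luc R h (suc (suc k))
      L₁ = Luc R h (suc k)
      L₀ = Luc R h k
      F₂ = Fib R h (suc (suc k))
      F₁ = Fib R h (suc k)

    binomialSum-natR-closed-form : ∀ m → let n = suc m in
      (1# + 1#) * Δ * binomialSum (natR R) m + (natR R 4 * Fib R h n + natR R n * h * Luc R h n)
        ≈ Δ * natR R n * Fib R h n
    binomialSum-natR-closed-form zero =
      solve 1 (λ x → con 2 :* (x :* x :+ ⟨4⟩) :* (con 0 :* (con 1 :+ con 0) :* con 1)
                       :+ (⟨4⟩ :* con 1 :+ (con 1 :+ con 0) :* x :* x)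
                     := (x :* x :+ ⟨4⟩) :* (con 1 :+ con 0) :* con 1) refl h
    binomialSum-natR-closed-form (suc zero) =
      solve 1 (λ x → con 2 :* (x :* x :+ ⟨4⟩)
                       :* (con 0 :* (con 1 :+ con 0) :* (x :* con 1) :+ (con 1 :+ con 0) :* con 0 :* con 1)
                       :+ (⟨4⟩ :* (x :* con 1 :+ con 0) :+ (con 1 :+ (con 1 :+ con 0)) :* x :* (x :* x :+ con 2))
                     := (x :* x :+ ⟨4⟩) :* (con 1 :+ (con 1 :+ con 0)) :* (x :* con 1 :+ con 0)) refl h
    binomialSum-natR-closed-form (suc (suc m)) = begin
      two * Δ * G₂ + (four * (h * F₂ + F₁) + (1# + (1# + n)) * h * (h * L₂ + L₁))
        ≈⟨ +-congʳ (*-congˡ (binomialSum-natR-rec m)) ⟩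
      two * Δ * (h * G₁ + (G₀ + F₁)) + (four * (h * F₂ + F₁) + (1# + (1# + n)) * h * (h * L₂ + L₁))
        ≈⟨ solve 10 (λ x D f G₁ G₀ F₂ F₁ L₂ L₁ n →
             con 2 :* D :* (x :* G₁ :+ (G₀ :+ F₁))
               :+ (f :* (x :* F₂ :+ F₁) :+ (con 1 :+ (con 1 :+ n)) :* x :* (x :* L₂ :+ L₁))
             := x :* (con 2 :* D :* G₁ :+ (f :* F₂ :+ (con 1 :+ n) :* x :* L₂))
                :+ (con 2 :* D :* G₀ :+ (f :* F₁ :+ n :* x :* L₁))
                :+ (x :* (x :* L₂ :+ con 2 :* L₁) :+ con 2 :* D :* F₁))
             refl h Δ four G₁ G₀ F₂ F₁ L₂ L₁ n ⟩
      h * (two * Δ * G₁ + (four * F₂ + (1# + n) * h * L₂))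
        + (two * Δ * G₀ + (four * F₁ + n * h * L₁))
        + (h * (h * L₂ + two * L₁) + two * Δ * F₁)
        ≈⟨ +-cong (+-cong (*-congˡ (binomialSum-natR-closed-form (suc m))) (binomialSum-natR-closed-form m))
                  (+-congʳ (*-congˡ (h*Luc+2*Luc≈Δ*Fib (suc m)))) ⟩
      h * (Δ * (1# + n) * F₂) + Δ * n * F₁ + (h * (Δ * F₂) + two * Δ * F₁)
        ≈⟨ solve 5 (λ x D F₂ F₁ n →
             x :* (D :* (con 1 :+ n) :* F₂) :+ D :* n :* F₁ :+ (x :* (D :* F₂) :+ con 2 :* D :* F₁)
             := D :* (con 1 :+ (con 1 :+ n)) :* (x :* F₂ :+ F₁))
             refl h Δ F₂ F₁ n ⟩
      Δ * (1# + (1# + n)) * (h * F₂ + F₁) ∎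
      where
      two = 1# + 1#
      four = natR R 4
      n = natR R (suc m)
      G₂ = binomialSum (natR R) (suc (suc m))
      G₁ = binomialSum (natR R) (suc m)
      G₀ = binomialSum (natR R) m
      F₂ = Fib R h (suc (suc m))
      F₁ = Fib R h (suc m)
      L₂ = Luc R h (suc (suc m))
      L₁ = Luc R h (suc m)

    lhsSum≈binomialSum-natR : ∀ m → lhsSum R h (suc m) ≈ binomialSum (natR R) m
    lhsSum≈binomialSum-natR m = begin
      lhsSum R h (suc m)
        ≈⟨ sumTo-cong (m / 2) (λ i → *-congˡ (reflexive (P.cong (powR R h) (ℕₚ.∸-+-assoc m i i)))) ⟨
      sumTo R (m / 2) (λ i → binomialTerm (natR R) i (m ∸ i))
        ≈⟨ sumTo-zero-tail _ (λ i m/2<i → binomialTerm-vanishes (natR R) (m/2<n⇒m∸n<n m i m/2<i))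
                             (m/n≤m m 2) ⟨
      sumTo R m (λ i → binomialTerm (natR R) i (m ∸ i))
        ≈⟨ sumTo≈antidiagonalSum m (binomialTerm (natR R)) ⟩
      binomialSum (natR R) m ∎

lemma6 : ∀ {c ℓ : Level} (R : CommutativeRing c ℓ) →
    let open CommutativeRing R in
    (h d : Carrier) →
    d * ((1# + 1#) * (h * h + natR R 4)) ≈ 1# →
    (n : ℕ) → 1 ≤ n →
    lhsSum R h n ≈
      (((h * h + natR R 4) * natR R n - natR R 4) * Fib R h n
        - natR R n * h * Luc R h n) * d
lemma6 R h d d*2Δ≈1 (suc m) _ =
  trans (lhsSum≈binomialSum-natR R h m)
        (d*a≈1⇒a*x≈y⇒x≈y*d R d*2Δ≈1
          (x+[yz+w]≈uz⇒x≈[u-y]z-w R (binomialSum-natR-closed-form R h m)))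
  where open CommutativeRing R using (trans)
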